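{- Let $n_1>n_2\ge2$ be integers. Then the mixed hypergraph $\mathcal H^{\star}_{n_1,n_2}=(X_{n_1,n_2},\mathcal C^{\star}_{n_1,n_2},\mathcal D_{n_1,n_2})$ is a one-realization of $\{n_1,n_2\}$.
   Context: A mixed hypergraph is a triple $\mathcal H=(X,\mathcal C,\mathcal D)$ where $X$ is a finite set and $\mathcal C,\mathcal D$ are families of subsets of $X$ ($\mathcal C$-edges and $\mathcal D$-edges). A proper $k$-coloring is a map from $X$ to a set of $k$ colors such that every $\mathcal C$-edge contains two vertices of a common color and every $\mathcal D$-edge contains two vertices of distinct colors; it is strict if all $k$ colors are used. Colorings are identified with partitions of $X$ into color classes. The feasible set is the set of $k$ for which a strict $k$-coloring exists; $r_k$ is the number of partitions arising as strict $k$-colorings. $\mathcal H$ is a one-realization of $S$ if its feasible set is $S$ and $r_k=1$ for all $k\in S$. Here $[m]=\{1,\ldots,m\}$, $X_{n_1,n_2}=\{(n_1,n_2)\}\cup\{(i,i): i\in[n_2-1]\}\cup\{(j,n_2),(j,1): n_2\le j\le n_1-1\}$; $\mathcal D_{n_1,n_2}$ = all pairs $\{(x_1,x_2),(y_1,y_2)\}$ of elements of $X_{n_1,n_2}$ with $x_1\ne y_1$ and $x_2\ne y_2$; $\mathcal C^{\star}_{n_1,n_2}$ consists of the triples $\{(j,n_2),(j,1),(j-1,1)\}$ for $n_2+1\le j\le n_1-1$; the triples $\{(j,1),(j,n_2),(j+1,n_2)\}$ for $n_2\le j\le n_1-1$; and the triple $\{(n_2,n_2),(n_2,1),(1,1)\}$.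 -}

module Defs where

open import Level using (0ℓ)
open import Data.Nat using (ℕ; suc; _≤_; _<_)
open import Data.Fin using (Fin)
open import Data.Product using (Σ; ∃; _×_; _,_; proj₁; proj₂)
open import Data.Sum using (_⊎_)
open import Data.List using (List; []; _∷_)
open import Data.List.Membership.Propositional using (_∈_)
open import Relation.Binary.PropositionalEquality using (_≡_; _≢_)
open import Relation.Nullary using (¬_)
open import Function.Bundles using (_⇔_)

-- A mixed hypergraph whose vertices are drawn from a type P of "points":
-- the vertex set X is the subset of P given by inX; C-edges and D-edges are
-- subsets of X, each given as a list of its elements (families are predicates
-- on such lists).
record MixedHypergraph (P : Set) : Set₁ where
  field
    inX : P → Set
    isC : List P → Set
    isD : List P → Set
open MixedHypergraph public

module _ {P : Set} (H : MixedHypergraph P) where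

  -- a k-coloring: a map from points to k colours (only values on X matter)
  Coloring : ℕ → Set
  Coloring k = P → Fin k

  Proper : ∀ {k} → Coloring k → Set
  Proper c =
    (∀ e → isC H e → Σ P λ x → Σ P λ y → x ∈ e × y ∈ e × x ≢ y × c x ≡ c y) ×
    (∀ e → isD H e → Σ P λ x → Σ P λ y → x ∈ e × y ∈ e × c x ≢ c y)

  Strict : ∀ {k} → Coloring k → Set
  Strict {k} c = ∀ (col : Fin k) → Σ P λ x → inX H x × c x ≡ col

  StrictColoring : ℕ → Set
  StrictColoring k = Σ (Coloring k) λ c → Proper c × Strict c

  Feasible : ℕ → Set
  Feasible k = StrictColoring k

  SamePartition : ∀ {k l} → Coloring k → Coloring l → Set
  SamePartition c c' = ∀ x y → inX H x → inX H y → (c x ≡ c y) ⇔ (c' x ≡ c' y)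

  UniqueStrict : ℕ → Set
  UniqueStrict k = StrictColoring k ×
    (∀ (c c' : StrictColoring k) → SamePartition (proj₁ c) (proj₁ c'))

  OneRealization : (ℕ → Set) → Set
  OneRealization S = (∀ k → Feasible k ⇔ S k) × (∀ k → S k → UniqueStrict k)

Point : Set
Point = ℕ × ℕ

InX : ℕ → ℕ → Point → Set
InX n₁ n₂ p =
  (p ≡ (n₁ , n₂)) ⊎
  (Σ ℕ λ i → 1 ≤ i × i < n₂ × p ≡ (i , i)) ⊎
  (Σ ℕ λ j → n₂ ≤ j × j < n₁ × (p ≡ (j , n₂) ⊎ p ≡ (j , 1)))

IsD : ℕ → ℕ → List Point → Set
IsD n₁ n₂ e = Σ Point λ x → Σ Point λ y →
  InX n₁ n₂ x × InX n₁ n₂ y × proj₁ x ≢ proj₁ y × proj₂ x ≢ proj₂ y ×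
  e ≡ x ∷ y ∷ []

IsCstar : ℕ → ℕ → List Point → Set
IsCstar n₁ n₂ e =
  (Σ ℕ λ j → suc n₂ ≤ j × j < n₁ × e ≡ (j , n₂) ∷ (j , 1) ∷ (j Data.Nat.∸ 1 , 1) ∷ []) ⊎
  (Σ ℕ λ j → n₂ ≤ j × j < n₁ × e ≡ (j , 1) ∷ (j , n₂) ∷ (suc j , n₂) ∷ []) ⊎
  (e ≡ (n₂ , n₂) ∷ (n₂ , 1) ∷ (1 , 1) ∷ [])

Hstar : ℕ → ℕ → MixedHypergraph Point
Hstar n₁ n₂ = record { inX = InX n₁ n₂ ; isC = IsCstar n₁ n₂ ; isD = IsD n₁ n₂ }

-- The vertices (j, n₂) and (j, 1), n₂ ≤ j < n₁, form a ladder, and the C-edges tie each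
-- rung to its neighbours. Since D-edges forbid equal colours on points differing in both
-- coordinates, a proper colouring either makes every rung monochromatic or every rung
-- bichromatic, according to the rung at n₂. In the first case the colour classes are exactly
-- the n₁ rows; in the second the upper rail takes the colour of (n₂, n₂) and the lower rail
-- that of (1, 1), so the classes are exactly the n₂ columns. Conversely, colouring by row or
-- by column is proper.

module Submission where

open import Defs
open import Data.Nat using (ℕ; suc; _≤_; _<_; _∸_; z≤n; s≤s; s≤s⁻¹; NonZero; >-nonZero; _<?_)
open import Data.Nat.Properties
open import Data.Nat.DivMod using (_mod_; m<n⇒m%n≡m)
open import Data.Fin using (Fin; toℕ)
open import Data.Fin.Properties using (toℕ-injective; toℕ-fromℕ<; toℕ<n; injective⇒≤) renaming (_≟_ to _≟ᶠ_)
open import Data.Sum using (_⊎_; inj₁; inj₂; map)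
open import Data.Product using (Σ; _×_; _,_; proj₁; proj₂)
open import Data.List using ([]; _∷_)
open import Data.List.Membership.Propositional using (_∈_)
open import Data.List.Relation.Unary.Any using (here; there)
open import Data.Empty using (⊥-elim)
open import Relation.Nullary using (¬_; yes; no)
open import Relation.Binary.PropositionalEquality using (_≡_; _≢_; refl; sym; trans; cong)
open import Function.Base using (_∘_)
open import Function.Bundles using (_⇔_; mk⇔; Equivalence)
open import Function.Construct.Symmetry using (⇔-sym)
open import Function.Construct.Composition using (_⇔-∘_)

toℕ-mod : ∀ {a m} .{{_ : NonZero m}} → a < m → toℕ (a mod m) ≡ a
toℕ-mod a<m = trans (toℕ-fromℕ< _) (m<n⇒m%n≡m a<m)

toℕ-mod-toℕ : ∀ {m} .{{_ : NonZero m}} (i : Fin m) → toℕ i mod m ≡ i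
toℕ-mod-toℕ i = toℕ-injective (toℕ-mod (toℕ<n i))

pred-mod-injective : ∀ {a b m} .{{_ : NonZero m}} → 1 ≤ a × a ≤ m → 1 ≤ b × b ≤ m →
                     (a ∸ 1) mod m ≡ (b ∸ 1) mod m → a ≡ b
pred-mod-injective {suc a} {suc b} (_ , a<m) (_ , b<m) e =
  cong suc (trans (sym (toℕ-mod a<m)) (trans (cong toℕ e) (toℕ-mod b<m)))

interval-induction : ∀ {a b} (P : ℕ → Set) → P a →
                     (∀ j → a ≤ j → suc j < b → P j → P (suc j)) →
                     ∀ j → a ≤ j → j < b → P j
interval-induction P base step j a≤j j<b with m≤n⇒m<n∨m≡n a≤j
... | inj₂ refl = base
interval-induction P base step (suc j) _ sj<b | inj₁ a<sj =
  step j (s≤s⁻¹ a<sj) sj<b (interval-induction P base step j (s≤s⁻¹ a<sj) (<⇒≤ sj<b))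

module _ {A B : Set} (f : A → B) where

  distinct-in-pair : ∀ {a b x y} → x ∈ a ∷ b ∷ [] → y ∈ a ∷ b ∷ [] → f x ≢ f y → f a ≢ f b
  distinct-in-pair (here refl)         (here refl)         fx≢fy = λ _ → fx≢fy refl
  distinct-in-pair (here refl)         (there (here refl)) fx≢fy = fx≢fy
  distinct-in-pair (there (here refl)) (here refl)         fx≢fy = λ e → fx≢fy (sym e)
  distinct-in-pair (there (here refl)) (there (here refl)) fx≢fy = λ _ → fx≢fy refl

  collision-in-triple : ∀ {a b d x y} → x ∈ a ∷ b ∷ d ∷ [] → y ∈ a ∷ b ∷ d ∷ [] → x ≢ y → f x ≡ f y →
                        f a ≡ f b ⊎ f a ≡ f d ⊎ f b ≡ f d
  collision-in-triple (here refl)                 (there (here refl))         _ e = inj₁ e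
  collision-in-triple (here refl)                 (there (there (here refl))) _ e = inj₂ (inj₁ e)
  collision-in-triple (there (here refl))         (there (there (here refl))) _ e = inj₂ (inj₂ e)
  collision-in-triple (there (here refl))         (here refl)                 _ e = inj₁ (sym e)
  collision-in-triple (there (there (here refl))) (here refl)                 _ e = inj₂ (inj₁ (sym e))
  collision-in-triple (there (there (here refl))) (there (here refl))         _ e = inj₂ (inj₂ (sym e))
  collision-in-triple (here refl)                 (here refl)                 x≢y _ = ⊥-elim (x≢y refl)
  collision-in-triple (there (here refl))         (there (here refl))         x≢y _ = ⊥-elim (x≢y refl)
  collision-in-triple (there (there (here refl))) (there (there (here refl))) x≢y _ = ⊥-elim (x≢y refl)

-- Colour i on the points labelled i + 1; `mod` only serves to make the map total.
byLabel : {P : Set} → (P → ℕ) → (m : ℕ) .{{_ : NonZero m}} → P → Fin m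
byLabel π m x = (π x ∸ 1) mod m

module _ {P : Set} (H : MixedHypergraph P) where

  Induces : ∀ {k} → Coloring H k → (P → ℕ) → Set
  Induces c π = ∀ x y → inX H x → inX H y → (c x ≡ c y) ⇔ (π x ≡ π y)

  MapsOnto : (P → ℕ) → ℕ → Set
  MapsOnto π m = (∀ x → inX H x → 1 ≤ π x × π x ≤ m) ×
                 (∀ (i : Fin m) → Σ P λ x → inX H x × π x ≡ suc (toℕ i))

  module _ {π : P → ℕ} {m : ℕ} .{{_ : NonZero m}} (onto : MapsOnto π m) where

    byLabel-induces : Induces (byLabel π m) π
    byLabel-induces x y x∈X y∈X =
      mk⇔ (pred-mod-injective (proj₁ onto x x∈X) (proj₁ onto y y∈X)) (cong λ a → (a ∸ 1) mod m)

    byLabel-strict : Strict H (byLabel π m)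
    byLabel-strict i with proj₂ onto i
    ... | x , x∈X , πx≡ = x , x∈X , trans (cong (λ a → (a ∸ 1) mod m) πx≡) (toℕ-mod-toℕ i)

    byLabel-proper :
      (∀ e → isC H e → Σ P λ x → Σ P λ y → x ∈ e × y ∈ e × x ≢ y × π x ≡ π y) →
      (∀ e → isD H e → Σ P λ x → Σ P λ y → inX H x × inX H y × x ∈ e × y ∈ e × π x ≢ π y) →
      Proper H (byLabel π m)
    byLabel-proper C-meets D-splits =
      (λ e C → let x , y , x∈e , y∈e , x≢y , πx≡πy = C-meets e C
               in x , y , x∈e , y∈e , x≢y , cong (λ a → (a ∸ 1) mod m) πx≡πy) ,
      (λ e D → let x , y , x∈X , y∈X , x∈e , y∈e , πx≢πy = D-splits e D
               in x , y , x∈e , y∈e , λ e → πx≢πy (Equivalence.to (byLabel-induces x y x∈X y∈X) e))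

    induces-size : ∀ {k} {c : Coloring H k} → Strict H c → Induces c π → k ≡ m
    induces-size {k} {c} strict c≈π = ≤-antisym (injective⇒≤ g-injective) (injective⇒≤ f-injective)
      where
      f : Fin m → Fin k
      f i = c (proj₁ (proj₂ onto i))
      f-injective : ∀ {i j} → f i ≡ f j → i ≡ j
      f-injective {i} {j} e with proj₂ onto i | proj₂ onto j
      ... | x , x∈X , πx | y , y∈X , πy =
        toℕ-injective (suc-injective (trans (sym πx) (trans (Equivalence.to (c≈π x y x∈X y∈X) e) πy)))
      g : Fin k → Fin m
      g col = byLabel π m (proj₁ (strict col))
      g-injective : ∀ {a b} → g a ≡ g b → a ≡ b
      g-injective {a} {b} e with strict a | strict b
      ... | x , x∈X , refl | y , y∈X , refl =
        Equivalence.from (c≈π x y x∈X y∈X) (Equivalence.to (byLabel-induces x y x∈X y∈X) e)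

  induces⇒samePartition : ∀ {k l π} {c : Coloring H k} {c' : Coloring H l} →
                          Induces c π → Induces c' π → SamePartition H c c'
  induces⇒samePartition c≈π c'≈π x y x∈X y∈X = ⇔-sym (c'≈π x y x∈X y∈X) ⇔-∘ c≈π x y x∈X y∈X

  induces-via-transversal : ∀ {k} {c : Coloring H k} {π : P → ℕ} (T : P → Set) →
    (∀ x → inX H x → Σ P λ t → T t × π t ≡ π x × c t ≡ c x) →
    (∀ {s t} → T s → T t → π s ≡ π t → s ≡ t) →
    (∀ {s t} → T s → T t → π s ≢ π t → c s ≢ c t) →
    Induces c π
  induces-via-transversal {c = c} {π} T normalise T-injective T-separated x y x∈X y∈X
    with normalise x x∈X | normalise y y∈X
  ... | s , s∈T , πs , cs | t , t∈T , πt , ct = mk⇔ to from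
    where
    to : c x ≡ c y → π x ≡ π y
    to cx≡cy with π s ≟ π t
    ... | yes πs≡πt = trans (sym πs) (trans πs≡πt πt)
    ... | no πs≢πt = ⊥-elim (T-separated s∈T t∈T πs≢πt (trans cs (trans cx≡cy (sym ct))))
    from : π x ≡ π y → c x ≡ c y
    from πx≡πy = trans (sym cs) (trans (cong c (T-injective s∈T t∈T (trans πs (trans πx≡πy (sym πt))))) ct)

module Star (n₁ n₂ : ℕ) (2≤n₂ : 2 ≤ n₂) (n₂<n₁ : n₂ < n₁) where

  H : MixedHypergraph Point
  H = Hstar n₁ n₂

  X : Point → Set
  X = InX n₁ n₂

  instance
    n₁-nonZero : NonZero n₁
    n₁-nonZero = >-nonZero (<-trans (≤-trans (s≤s z≤n) 2≤n₂) n₂<n₁)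
    n₂-nonZero : NonZero n₂
    n₂-nonZero = >-nonZero (≤-trans (s≤s z≤n) 2≤n₂)

  1≤n₂ : 1 ≤ n₂
  1≤n₂ = ≤-trans (s≤s z≤n) 2≤n₂

  n₂≢1 : n₂ ≢ 1
  n₂≢1 = >⇒≢ 2≤n₂

  upper≢lower : ∀ {i j} → _≢_ {A = Point} (i , n₂) (j , 1)
  upper≢lower e = n₂≢1 (cong proj₂ e)

  diagonal∈X : ∀ {i} → 1 ≤ i → i ≤ n₂ → X (i , i)
  diagonal∈X {i} 1≤i i≤n₂ with m≤n⇒m<n∨m≡n i≤n₂
  ... | inj₁ i<n₂ = inj₂ (inj₁ (i , 1≤i , i<n₂ , refl))
  ... | inj₂ refl = inj₂ (inj₂ (n₂ , ≤-refl , n₂<n₁ , inj₁ refl))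

  upper∈X : ∀ {j} → n₂ ≤ j → j ≤ n₁ → X (j , n₂)
  upper∈X {j} n₂≤j j≤n₁ with m≤n⇒m<n∨m≡n j≤n₁
  ... | inj₁ j<n₁ = inj₂ (inj₂ (j , n₂≤j , j<n₁ , inj₁ refl))
  ... | inj₂ refl = inj₁ refl

  lower∈X : ∀ {j} → n₂ ≤ j → j < n₁ → X (j , 1)
  lower∈X {j} n₂≤j j<n₁ = inj₂ (inj₂ (j , n₂≤j , j<n₁ , inj₂ refl))

  rows-onto : MapsOnto H proj₁ n₁
  rows-onto = range , representative
    where
    range : ∀ x → X x → 1 ≤ proj₁ x × proj₁ x ≤ n₁
    range _ (inj₁ refl) = <⇒≤ (≤-<-trans 1≤n₂ n₂<n₁) , ≤-refl
    range _ (inj₂ (inj₁ (i , 1≤i , i<n₂ , refl))) = 1≤i , ≤-trans (<⇒≤ i<n₂) (<⇒≤ n₂<n₁)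
    range _ (inj₂ (inj₂ (j , n₂≤j , j<n₁ , inj₁ refl))) = ≤-trans 1≤n₂ n₂≤j , <⇒≤ j<n₁
    range _ (inj₂ (inj₂ (j , n₂≤j , j<n₁ , inj₂ refl))) = ≤-trans 1≤n₂ n₂≤j , <⇒≤ j<n₁
    representative : ∀ (i : Fin n₁) → Σ Point λ x → X x × proj₁ x ≡ suc (toℕ i)
    representative i with suc (toℕ i) <? n₂
    ... | yes a<n₂ = _ , diagonal∈X (s≤s z≤n) (<⇒≤ a<n₂) , refl
    ... | no a≮n₂ = _ , upper∈X (≮⇒≥ a≮n₂) (toℕ<n i) , refl

  columns-onto : MapsOnto H proj₂ n₂
  columns-onto = range , λ i → _ , diagonal∈X (s≤s z≤n) (toℕ<n i) , refl
    where
    range : ∀ x → X x → 1 ≤ proj₂ x × proj₂ x ≤ n₂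
    range _ (inj₁ refl) = 1≤n₂ , ≤-refl
    range _ (inj₂ (inj₁ (i , 1≤i , i<n₂ , refl))) = 1≤i , <⇒≤ i<n₂
    range _ (inj₂ (inj₂ (j , n₂≤j , j<n₁ , inj₁ refl))) = 1≤n₂ , ≤-refl
    range _ (inj₂ (inj₂ (j , n₂≤j , j<n₁ , inj₂ refl))) = ≤-refl , 1≤n₂

  C-edges-meet-rows : ∀ e → IsCstar n₁ n₂ e →
                      Σ Point λ x → Σ Point λ y → x ∈ e × y ∈ e × x ≢ y × proj₁ x ≡ proj₁ y
  C-edges-meet-rows _ (inj₁ (_ , _ , _ , refl)) = _ , _ , here refl , there (here refl) , upper≢lower , refl
  C-edges-meet-rows _ (inj₂ (inj₁ (_ , _ , _ , refl))) = _ , _ , here refl , there (here refl) , upper≢lower ∘ sym , refl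
  C-edges-meet-rows _ (inj₂ (inj₂ refl)) = _ , _ , here refl , there (here refl) , upper≢lower , refl

  C-edges-meet-columns : ∀ e → IsCstar n₁ n₂ e →
                         Σ Point λ x → Σ Point λ y → x ∈ e × y ∈ e × x ≢ y × proj₂ x ≡ proj₂ y
  C-edges-meet-columns _ (inj₁ (suc _ , _ , _ , refl)) =
    _ , _ , there (here refl) , there (there (here refl)) , 1+n≢n ∘ cong proj₁ , refl
  C-edges-meet-columns _ (inj₂ (inj₁ (_ , _ , _ , refl))) =
    _ , _ , there (here refl) , there (there (here refl)) , 1+n≢n ∘ sym ∘ cong proj₁ , refl
  C-edges-meet-columns _ (inj₂ (inj₂ refl)) =
    _ , _ , there (here refl) , there (there (here refl)) , n₂≢1 ∘ cong proj₁ , refl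

  D-edges-split : (π : Point → ℕ) → (∀ {x y : Point} → proj₁ x ≢ proj₁ y → proj₂ x ≢ proj₂ y → π x ≢ π y) →
                  ∀ e → IsD n₁ n₂ e → Σ Point λ x → Σ Point λ y → X x × X y × x ∈ e × y ∈ e × π x ≢ π y
  D-edges-split π split _ (x , y , x∈X , y∈X , ≢₁ , ≢₂ , refl) =
    x , y , x∈X , y∈X , here refl , there (here refl) , split ≢₁ ≢₂

  n₁-feasible : Feasible H n₁
  n₁-feasible = byLabel proj₁ n₁ ,
                byLabel-proper H rows-onto C-edges-meet-rows (D-edges-split proj₁ λ ≢₁ _ → ≢₁) ,
                byLabel-strict H rows-onto

  n₂-feasible : Feasible H n₂
  n₂-feasible = byLabel proj₂ n₂ ,
                byLabel-proper H columns-onto C-edges-meet-columns (D-edges-split proj₂ λ _ ≢₂ → ≢₂) ,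
                byLabel-strict H columns-onto

  RowTransversal : Point → Set
  RowTransversal t = (Σ ℕ λ i → 1 ≤ i × i < n₂ × t ≡ (i , i)) ⊎ (Σ ℕ λ r → n₂ ≤ r × r ≤ n₁ × t ≡ (r , n₂))

  row-transversal-injective : ∀ {s t} → RowTransversal s → RowTransversal t → proj₁ s ≡ proj₁ t → s ≡ t
  row-transversal-injective (inj₁ (_ , _ , _ , refl)) (inj₁ (_ , _ , _ , refl)) refl = refl
  row-transversal-injective (inj₂ (_ , _ , _ , refl)) (inj₂ (_ , _ , _ , refl)) refl = refl
  row-transversal-injective (inj₁ (_ , _ , i<n₂ , refl)) (inj₂ (_ , n₂≤i , _ , refl)) refl = ⊥-elim (<⇒≱ i<n₂ n₂≤i)
  row-transversal-injective (inj₂ (_ , n₂≤i , _ , refl)) (inj₁ (_ , _ , i<n₂ , refl)) refl = ⊥-elim (<⇒≱ i<n₂ n₂≤i)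

  ColumnTransversal : Point → Set
  ColumnTransversal t = Σ ℕ λ i → 1 ≤ i × i ≤ n₂ × t ≡ (i , i)

  column-transversal-injective : ∀ {s t} → ColumnTransversal s → ColumnTransversal t → proj₂ s ≡ proj₂ t → s ≡ t
  column-transversal-injective (_ , _ , _ , refl) (_ , _ , _ , refl) refl = refl

  module ProperColoring {k : ℕ} (c : Coloring H k) (proper : Proper H c) where

    separated : ∀ {x y} → X x → X y → proj₁ x ≢ proj₁ y → proj₂ x ≢ proj₂ y → c x ≢ c y
    separated {x} {y} x∈X y∈X ≢₁ ≢₂ =
      let _ , _ , u∈e , v∈e , cu≢cv = proj₂ proper (x ∷ y ∷ []) (x , y , x∈X , y∈X , ≢₁ , ≢₂ , refl)
      in distinct-in-pair c u∈e v∈e cu≢cv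

    merged : ∀ {a b d} → IsCstar n₁ n₂ (a ∷ b ∷ d ∷ []) → c a ≡ c b ⊎ c a ≡ c d ⊎ c b ≡ c d
    merged C = let _ , _ , u∈e , v∈e , u≢v , cu≡cv = proj₁ proper _ C
               in collision-in-triple c u∈e v∈e u≢v cu≡cv

    rails-separated : ∀ {i j} → n₂ ≤ i → i ≤ n₁ → n₂ ≤ j → j < n₁ → i ≢ j → c (i , n₂) ≢ c (j , 1)
    rails-separated n₂≤i i≤n₁ n₂≤j j<n₁ i≢j = separated (upper∈X n₂≤i i≤n₁) (lower∈X n₂≤j j<n₁) i≢j n₂≢1

    MonochromaticRung : ℕ → Set
    MonochromaticRung j = c (j , n₂) ≡ c (j , 1)

    lower-step : ∀ {j} → n₂ ≤ j → suc j < n₁ → MonochromaticRung (suc j) ⊎ c (suc j , 1) ≡ c (j , 1)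
    lower-step {j} n₂≤j sj<n₁ with merged (inj₁ (suc j , s≤s n₂≤j , sj<n₁ , refl))
    ... | inj₁ mono = inj₁ mono
    ... | inj₂ (inj₂ e) = inj₂ e
    ... | inj₂ (inj₁ e) =
      ⊥-elim (rails-separated (m≤n⇒m≤1+n n₂≤j) (<⇒≤ sj<n₁) n₂≤j (<⇒≤ sj<n₁) 1+n≢n e)

    upper-step : ∀ {j} → n₂ ≤ j → j < n₁ → MonochromaticRung j ⊎ c (j , n₂) ≡ c (suc j , n₂)
    upper-step {j} n₂≤j j<n₁ with merged (inj₂ (inj₁ (j , n₂≤j , j<n₁ , refl)))
    ... | inj₁ e = inj₁ (sym e)
    ... | inj₂ (inj₂ e) = inj₂ e
    ... | inj₂ (inj₁ e) = ⊥-elim (rails-separated (m≤n⇒m≤1+n n₂≤j) j<n₁ n₂≤j j<n₁ 1+n≢n (sym e))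

    corner-step : MonochromaticRung n₂ ⊎ c (n₂ , 1) ≡ c (1 , 1)
    corner-step with merged (inj₂ (inj₂ refl))
    ... | inj₁ mono = inj₁ mono
    ... | inj₂ (inj₂ e) = inj₂ e
    ... | inj₂ (inj₁ e) = ⊥-elim (separated (diagonal∈X 1≤n₂ ≤-refl) (diagonal∈X ≤-refl 1≤n₂) n₂≢1 n₂≢1 e)

    monochromatic-ladder : MonochromaticRung n₂ → ∀ j → n₂ ≤ j → j < n₁ → MonochromaticRung j
    monochromatic-ladder mono = interval-induction MonochromaticRung mono step
      where
      step : ∀ j → n₂ ≤ j → suc j < n₁ → MonochromaticRung j → MonochromaticRung (suc j)
      step j n₂≤j sj<n₁ mono-j with lower-step n₂≤j sj<n₁
      ... | inj₁ mono-sj = mono-sj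
      ... | inj₂ e = ⊥-elim (rails-separated n₂≤j (<⇒≤ (<⇒≤ sj<n₁)) (m≤n⇒m≤1+n n₂≤j) sj<n₁
                               (1+n≢n ∘ sym) (trans mono-j (sym e)))

    bichromatic-ladder : ¬ MonochromaticRung n₂ → ∀ j → n₂ ≤ j → j < n₁ → ¬ MonochromaticRung j
    bichromatic-ladder bi = interval-induction (¬_ ∘ MonochromaticRung) bi step
      where
      step : ∀ j → n₂ ≤ j → suc j < n₁ → ¬ MonochromaticRung j → ¬ MonochromaticRung (suc j)
      step j n₂≤j sj<n₁ bi-j mono-sj with upper-step n₂≤j (<⇒≤ sj<n₁)
      ... | inj₁ mono-j = bi-j mono-j
      ... | inj₂ e = rails-separated n₂≤j (<⇒≤ (<⇒≤ sj<n₁)) (m≤n⇒m≤1+n n₂≤j) sj<n₁ (1+n≢n ∘ sym) (trans e mono-sj)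

    module Bichromatic (bi : ¬ MonochromaticRung n₂) where

      upper-rail-constant : ∀ j → n₂ ≤ j → j ≤ n₁ → c (j , n₂) ≡ c (n₂ , n₂)
      upper-rail-constant j n₂≤j j≤n₁ = interval-induction (λ i → c (i , n₂) ≡ c (n₂ , n₂)) refl step j n₂≤j (s≤s j≤n₁)
        where
        step : ∀ i → n₂ ≤ i → suc i < suc n₁ → c (i , n₂) ≡ c (n₂ , n₂) → c (suc i , n₂) ≡ c (n₂ , n₂)
        step i n₂≤i si<sn₁ ih with upper-step n₂≤i (s≤s⁻¹ si<sn₁)
        ... | inj₁ mono-i = ⊥-elim (bichromatic-ladder bi i n₂≤i (s≤s⁻¹ si<sn₁) mono-i)
        ... | inj₂ e = trans (sym e) ih

      lower-rail-constant : ∀ j → n₂ ≤ j → j < n₁ → c (j , 1) ≡ c (1 , 1)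
      lower-rail-constant = interval-induction (λ i → c (i , 1) ≡ c (1 , 1)) base step
        where
        base : c (n₂ , 1) ≡ c (1 , 1)
        base with corner-step
        ... | inj₁ mono = ⊥-elim (bi mono)
        ... | inj₂ e = e
        step : ∀ i → n₂ ≤ i → suc i < n₁ → c (i , 1) ≡ c (1 , 1) → c (suc i , 1) ≡ c (1 , 1)
        step i n₂≤i si<n₁ ih with lower-step n₂≤i si<n₁
        ... | inj₁ mono-si = ⊥-elim (bichromatic-ladder bi (suc i) (m≤n⇒m≤1+n n₂≤i) si<n₁ mono-si)
        ... | inj₂ e = trans e ih

    rows-induce : MonochromaticRung n₂ → Induces H c proj₁
    rows-induce mono = induces-via-transversal H RowTransversal normalise row-transversal-injective separate
      where
      mono-rung : ∀ j → n₂ ≤ j → j < n₁ → MonochromaticRung j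
      mono-rung = monochromatic-ladder mono
      normalise : ∀ x → X x → Σ Point λ t → RowTransversal t × proj₁ t ≡ proj₁ x × c t ≡ c x
      normalise _ (inj₁ refl) = _ , inj₂ (n₁ , <⇒≤ n₂<n₁ , ≤-refl , refl) , refl , refl
      normalise _ (inj₂ (inj₁ diagonal)) = _ , inj₁ diagonal , refl , refl
      normalise _ (inj₂ (inj₂ (j , n₂≤j , j<n₁ , inj₁ refl))) = _ , inj₂ (j , n₂≤j , <⇒≤ j<n₁ , refl) , refl , refl
      normalise _ (inj₂ (inj₂ (j , n₂≤j , j<n₁ , inj₂ refl))) =
        _ , inj₂ (j , n₂≤j , <⇒≤ j<n₁ , refl) , refl , mono-rung j n₂≤j j<n₁
      upper-separated : ∀ {r s} → n₂ ≤ r → r < n₁ → n₂ ≤ s → s ≤ n₁ → r ≢ s → c (r , n₂) ≢ c (s , n₂)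
      upper-separated n₂≤r r<n₁ n₂≤s s≤n₁ r≢s e =
        rails-separated n₂≤s s≤n₁ n₂≤r r<n₁ (r≢s ∘ sym) (trans (sym e) (mono-rung _ n₂≤r r<n₁))
      separate : ∀ {s t} → RowTransversal s → RowTransversal t → proj₁ s ≢ proj₁ t → c s ≢ c t
      separate (inj₁ (i , 1≤i , i<n₂ , refl)) (inj₁ (i' , 1≤i' , i'<n₂ , refl)) i≢i' =
        separated (diagonal∈X 1≤i (<⇒≤ i<n₂)) (diagonal∈X 1≤i' (<⇒≤ i'<n₂)) i≢i' i≢i'
      separate (inj₁ (i , 1≤i , i<n₂ , refl)) (inj₂ (r , n₂≤r , r≤n₁ , refl)) i≢r =
        separated (diagonal∈X 1≤i (<⇒≤ i<n₂)) (upper∈X n₂≤r r≤n₁) i≢r (<⇒≢ i<n₂)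
      separate (inj₂ (r , n₂≤r , r≤n₁ , refl)) (inj₁ (i , 1≤i , i<n₂ , refl)) r≢i =
        separated (upper∈X n₂≤r r≤n₁) (diagonal∈X 1≤i (<⇒≤ i<n₂)) r≢i (>⇒≢ i<n₂)
      separate (inj₂ (r , n₂≤r , r≤n₁ , refl)) (inj₂ (s , n₂≤s , s≤n₁ , refl)) r≢s with r <? n₁
      -- (n₁, 1) is not a vertex, so pass through the lower rail at whichever of r, s lies below n₁
      ... | yes r<n₁ = upper-separated n₂≤r r<n₁ n₂≤s s≤n₁ r≢s
      ... | no r≮n₁ = upper-separated n₂≤s (≤∧≢⇒< s≤n₁ s≢n₁) n₂≤r r≤n₁ (r≢s ∘ sym) ∘ sym
        where
        s≢n₁ : s ≢ n₁
        s≢n₁ refl = r≢s (≤-antisym r≤n₁ (≮⇒≥ r≮n₁))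

    columns-induce : ¬ MonochromaticRung n₂ → Induces H c proj₂
    columns-induce bi = induces-via-transversal H ColumnTransversal normalise column-transversal-injective separate
      where
      open Bichromatic bi
      normalise : ∀ x → X x → Σ Point λ t → ColumnTransversal t × proj₂ t ≡ proj₂ x × c t ≡ c x
      normalise _ (inj₁ refl) =
        _ , (n₂ , 1≤n₂ , ≤-refl , refl) , refl , sym (upper-rail-constant n₁ (<⇒≤ n₂<n₁) ≤-refl)
      normalise _ (inj₂ (inj₁ (i , 1≤i , i<n₂ , refl))) = _ , (i , 1≤i , <⇒≤ i<n₂ , refl) , refl , refl
      normalise _ (inj₂ (inj₂ (j , n₂≤j , j<n₁ , inj₁ refl))) =
        _ , (n₂ , 1≤n₂ , ≤-refl , refl) , refl , sym (upper-rail-constant j n₂≤j (<⇒≤ j<n₁))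
      normalise _ (inj₂ (inj₂ (j , n₂≤j , j<n₁ , inj₂ refl))) =
        _ , (1 , ≤-refl , 1≤n₂ , refl) , refl , sym (lower-rail-constant j n₂≤j j<n₁)
      separate : ∀ {s t} → ColumnTransversal s → ColumnTransversal t → proj₂ s ≢ proj₂ t → c s ≢ c t
      separate (_ , 1≤i , i≤n₂ , refl) (_ , 1≤i' , i'≤n₂ , refl) i≢i' =
        separated (diagonal∈X 1≤i i≤n₂) (diagonal∈X 1≤i' i'≤n₂) i≢i' i≢i'

    rows-or-columns : Induces H c proj₁ ⊎ Induces H c proj₂
    rows-or-columns with c (n₂ , n₂) ≟ᶠ c (n₂ , 1)
    ... | yes mono = inj₁ (rows-induce mono)
    ... | no bi = inj₂ (columns-induce bi)

  classify : ∀ {k} (c : Coloring H k) → Proper H c → Strict H c →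
             (k ≡ n₁ × Induces H c proj₁) ⊎ (k ≡ n₂ × Induces H c proj₂)
  classify c proper strict with ProperColoring.rows-or-columns c proper
  ... | inj₁ c≈rows = inj₁ (induces-size H rows-onto strict c≈rows , c≈rows)
  ... | inj₂ c≈columns = inj₂ (induces-size H columns-onto strict c≈columns , c≈columns)

  feasible⇒n₁⊎n₂ : ∀ k → Feasible H k → k ≡ n₁ ⊎ k ≡ n₂
  feasible⇒n₁⊎n₂ k (c , proper , strict) = map proj₁ proj₁ (classify c proper strict)

  n₁⊎n₂⇒feasible : ∀ k → k ≡ n₁ ⊎ k ≡ n₂ → Feasible H k
  n₁⊎n₂⇒feasible _ (inj₁ refl) = n₁-feasible
  n₁⊎n₂⇒feasible _ (inj₂ refl) = n₂-feasible

  unique-partition : ∀ k (c c' : StrictColoring H k) → SamePartition H (proj₁ c) (proj₁ c')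
  unique-partition k (c , p , s) (c' , p' , s') with classify c p s | classify c' p' s'
  ... | inj₁ (_ , c≈rows) | inj₁ (_ , c'≈rows) = induces⇒samePartition H c≈rows c'≈rows
  ... | inj₂ (_ , c≈columns) | inj₂ (_ , c'≈columns) = induces⇒samePartition H c≈columns c'≈columns
  ... | inj₁ (refl , _) | inj₂ (n₁≡n₂ , _) = ⊥-elim (>⇒≢ n₂<n₁ n₁≡n₂)
  ... | inj₂ (refl , _) | inj₁ (n₂≡n₁ , _) = ⊥-elim (<⇒≢ n₂<n₁ n₂≡n₁)

lemma3p3 : (n₁ n₂ : ℕ) → 2 ≤ n₂ → n₂ < n₁ →
    OneRealization (Hstar n₁ n₂) (λ k → k ≡ n₁ ⊎ k ≡ n₂)
lemma3p3 n₁ n₂ 2≤n₂ n₂<n₁ =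
  (λ k → mk⇔ (feasible⇒n₁⊎n₂ k) (n₁⊎n₂⇒feasible k)) ,
  (λ k k∈S → n₁⊎n₂⇒feasible k k∈S , unique-partition k)
  where open Star n₁ n₂ 2≤n₂ n₂<n₁
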